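{- Let $\Sigma$ be a finite alphabet with at least two symbols. There is no algorithm with oracle access which, for every strongly almost periodic sequence $\omega\in\Sigma^{\mathbb{N}}$ and every almost periodicity regulator $f$ of $\omega$, given oracle access to $\omega$ and $f$, halts and correctly decides whether $\omega$ is periodic.
   Context: A sequence $\omega$ is periodic if there is $T\ge1$ with $\omega(i)=\omega(i+T)$ for all $i\in\mathbb{N}$. Write $\omega[i,j]=\omega(i)\dots\omega(j)$ and $\omega[i,\infty)$ for the suffix starting at $i$; a factor is a nonempty string $\omega[i,j]$. A sequence is strongly almost periodic if for every factor $x$ there is $l$ such that every factor of length $l$ contains an occurrence of $x$. A function $r\colon\mathbb{N}\to\mathbb{N}$ is an almost periodicity regulator of $\omega$ if (1) every string of length $k$ occurring in $\omega$ infinitely many times occurs in every factor of $\omega$ of length $r(k)$, and (2) every string of length $k$ occurring in $\omega$ only finitely many times does not occur in $\omega[r(k),\infty)$. An algorithm with oracle access to $\omega$ and $f$ may query values $\omega(i)$ and $f(i)$. -}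

module Defs where

open import Data.Nat using (ℕ; zero; suc; _+_; _≤_; _<_)
open import Data.Fin using (Fin; toℕ)
open import Data.Vec using (Vec; lookup; tabulate)
open import Data.List using (List; []; _∷_)
open import Data.Bool using (Bool)
open import Data.Maybe using (Maybe; just; nothing)
open import Data.Sum using (_⊎_; inj₁; inj₂)
open import Data.Product using (Σ; ∃; _×_; _,_)
open import Relation.Nullary using (¬_)
open import Relation.Binary.PropositionalEquality using (_≡_)

Seq : ℕ → Set
Seq k = ℕ → Fin k

Periodic : ∀ {k} → Seq k → Set
Periodic ω = Σ ℕ λ T → (1 ≤ T) × (∀ i → ω i ≡ ω (i + T))

OccursAt : ∀ {k n} → Seq k → Vec (Fin k) n → ℕ → Set
OccursAt ω x p = ∀ m → ω (p + toℕ m) ≡ lookup x m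

OccursInWindow : ∀ {k n} → Seq k → Vec (Fin k) n → ℕ → ℕ → Set
OccursInWindow {n = n} ω x i l =
  Σ ℕ λ p → (i ≤ p) × (p + n ≤ i + l) × OccursAt ω x p

-- the factor ω[i, i+n] (of length n+1, nonempty)
factor : ∀ {k} → Seq k → ℕ → (n : ℕ) → Vec (Fin k) (suc n)
factor ω i n = tabulate (λ m → ω (i + toℕ m))

StronglyAlmostPeriodic : ∀ {k} → Seq k → Set
StronglyAlmostPeriodic ω =
  ∀ i n → Σ ℕ λ l → ∀ s → OccursInWindow ω (factor ω i n) s l

OccursInfinitelyOften : ∀ {k n} → Seq k → Vec (Fin k) n → Set
OccursInfinitelyOften ω x = ∀ N → Σ ℕ λ p → (N ≤ p) × OccursAt ω x p

Regulator : ∀ {k} → Seq k → (ℕ → ℕ) → Set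
Regulator {k} ω r =
  (∀ n (x : Vec (Fin k) n) → OccursInfinitelyOften ω x →
     ∀ s → OccursInWindow ω x s (r n))
  × (∀ n (x : Vec (Fin k) n) → ¬ OccursInfinitelyOften ω x →
     ∀ p → r n ≤ p → ¬ OccursAt ω x p)

-- Oracle algorithms: at each step, given the history of oracle answers
-- so far (most recent first), either ask a query to ω or to f, or halt
-- with a Boolean answer.
data Query : Set where
  qω : ℕ → Query
  qf : ℕ → Query

Answer : ℕ → Set
Answer k = Fin k ⊎ ℕ

data Action : Set where
  ask  : Query → Action
  halt : Bool → Action

OracleAlgorithm : ℕ → Set
OracleAlgorithm k = List (Answer k) → Action

answer : ∀ {k} → Seq k → (ℕ → ℕ) → Query → Answer k
answer ω f (qω i) = inj₁ (ω i)
answer ω f (qf i) = inj₂ (f i)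

run : ∀ {k} → ℕ → OracleAlgorithm k → Seq k → (ℕ → ℕ) → List (Answer k) → Maybe Bool
run fuel A ω f h with A h
... | halt b = just b
... | ask q with fuel
...   | zero = nothing
...   | suc fuel′ = run fuel′ A ω f (answer ω f q ∷ h)

HaltsWith : ∀ {k} → OracleAlgorithm k → Seq k → (ℕ → ℕ) → Bool → Set
HaltsWith A ω f b = Σ ℕ λ n → run n A ω f [] ≡ just b

-- Put ω(i) = g(ν₂(i+1)) with ν₂ the 2-adic valuation. If from every m on g only takes the
-- values g(m) and g(m+1), then shifting a factor of length n by a suitable multiple of 2ⁿ
-- reproduces it: positions of valuation < n do not change, and the single position of
-- valuation ≥ n can be moved to valuation exactly n or n + 1. Hence every factor of length n
-- recurs in each window of length 5·2ⁿ + n, and this one regulator serves all such g.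
-- For g alternating between two symbols ω is not periodic, while ω built from g(min(l, j))
-- has period 2ʲ and agrees with ω below 2ʲ - 1. A run that halts on ω has queried ω only
-- below some bound B, so it answers the same on the periodic sequence for j = B, with the
-- same regulator; thus it errs on one of the two.

module Submission where

open import Defs
open import Data.Bool using (Bool; true; false; not)
open import Data.Empty using (⊥)
open import Data.Fin using (Fin; zero; suc; toℕ)
open import Data.Fin.Properties using (toℕ<n)
open import Data.List using (List; []; _∷_)
open import Data.Maybe using (just)
open import Data.Maybe.Properties using (just-injective)
open import Data.Nat
open import Data.Nat.Divisibility using (_∣_; divides; ∣m∣n⇒∣m+n; ∣-refl; ∣⇒≤)
open import Data.Nat.DivMod using (_%_; _/_; m≡m%n+[m/n]*n; m%n<n; m/n*n≤m)
open import Data.Nat.Induction using (<-rec)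
open import Data.Nat.Properties
open import Data.Nat.Tactic.RingSolver using (solve-∀)
open import Data.Product using (Σ; ∃₂; ∃-syntax; _×_; _,_; proj₁; proj₂)
open import Data.Sum using (_⊎_; inj₁; inj₂)
import Data.Sum as Sum
open import Data.Vec using (Vec)
open import Data.Vec.Properties using (lookup∘tabulate)
open import Function using (_∘_)
open import Relation.Nullary using (¬_; yes; no; contradiction)
open import Relation.Binary.PropositionalEquality

n<2^n : ∀ n → n < 2 ^ n
n<2^n zero    = z<s
n<2^n (suc n) = begin-strict
  suc n          ≤⟨ n<2^n n ⟩
  2 ^ n          <⟨ m<m+n (2 ^ n) (<-≤-trans (m^n>0 2 n) (m≤m+n _ 0)) ⟩
  2 ^ n + (2 ^ n + 0) ∎
  where open ≤-Reasoning

even-or-odd : ∀ n → ∃[ m ] (n ≡ 2 * m ⊎ n ≡ 1 + 2 * m)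
even-or-odd zero = 0 , inj₁ refl
even-or-odd (suc n) with even-or-odd n
... | m , inj₁ n≡2m   = m , inj₂ (cong suc n≡2m)
... | m , inj₂ n≡1+2m = suc m , inj₁ (trans (cong suc n≡1+2m) (sym (*-suc 2 m)))

OddDecomposition : ℕ → Set
OddDecomposition n = ∃₂ λ v u → n ≡ 2 ^ v * (1 + 2 * u)

odd-decomposition : ∀ n → OddDecomposition (suc n)
odd-decomposition = <-rec (OddDecomposition ∘ suc) step
  where
  step : ∀ n → (∀ {m} → m < n → OddDecomposition (suc m)) → OddDecomposition (suc n)
  step n rec with even-or-odd (suc n)
  ... | u , inj₂ odd = 0 , u , trans odd (sym (*-identityˡ (1 + 2 * u)))
  ... | suc m , inj₁ even with rec (subst (m <_) (sym (suc-injective even)) (m<m+n m z<s))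
  ...   | v , u , e = suc v , u , trans even (trans (cong (2 *_) e) (sym (*-assoc 2 (2 ^ v) _)))

2^*odd-injective : ∀ v w u x → 2 ^ v * (1 + 2 * u) ≡ 2 ^ w * (1 + 2 * x) → v ≡ w
2^*odd-injective zero zero _ _ _ = refl
2^*odd-injective zero (suc w) u x e =
  contradiction (sym (trans (sym (*-identityˡ _)) (trans e (*-assoc 2 (2 ^ w) _))))
                (even≢odd (2 ^ w * (1 + 2 * x)) u)
2^*odd-injective (suc v) zero u x e =
  contradiction (trans (sym (*-assoc 2 (2 ^ v) _)) (trans e (*-identityˡ _)))
                (even≢odd (2 ^ v * (1 + 2 * u)) x)
2^*odd-injective (suc v) (suc w) u x e = cong suc (2^*odd-injective v w u x
  (*-cancelˡ-≡ _ _ 2 (trans (sym (*-assoc 2 (2 ^ v) _)) (trans e (*-assoc 2 (2 ^ w) _)))))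

-- The 2-adic valuation; the value at 0 is junk.
ν₂ : ℕ → ℕ
ν₂ zero    = zero
ν₂ (suc n) = proj₁ (odd-decomposition n)

ν₂-decomposition : ∀ n → ∃[ u ] suc n ≡ 2 ^ ν₂ (suc n) * (1 + 2 * u)
ν₂-decomposition n = proj₂ (odd-decomposition n)

ν₂-2^*odd : ∀ v u → ν₂ (2 ^ v * (1 + 2 * u)) ≡ v
ν₂-2^*odd v u with 2 ^ v * (1 + 2 * u) in e
... | zero  = contradiction e (≢-nonZero⁻¹ _ {{m*n≢0 (2 ^ v) (1 + 2 * u) {{m^n≢0 2 v}}}})
... | suc n with ν₂-decomposition n
...   | w , e′ = 2^*odd-injective (ν₂ (suc n)) v w u (sym (trans e e′))

ν₂-*2^ : ∀ w n → ν₂ (suc w * 2 ^ n) ≡ ν₂ (suc w) + n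
ν₂-*2^ w n with ν₂-decomposition w
... | u , e = begin
  ν₂ (suc w * 2 ^ n)                  ≡⟨ cong (λ m → ν₂ (m * 2 ^ n)) e ⟩
  ν₂ (2 ^ v * o * 2 ^ n)              ≡⟨ cong ν₂ (*-assoc (2 ^ v) o (2 ^ n)) ⟩
  ν₂ (2 ^ v * (o * 2 ^ n))            ≡⟨ cong (λ m → ν₂ (2 ^ v * m)) (*-comm o (2 ^ n)) ⟩
  ν₂ (2 ^ v * (2 ^ n * o))            ≡⟨ cong ν₂ (sym (*-assoc (2 ^ v) (2 ^ n) o)) ⟩
  ν₂ (2 ^ v * 2 ^ n * o)              ≡⟨ cong (λ m → ν₂ (m * o)) (sym (^-distribˡ-+-* 2 v n)) ⟩
  ν₂ (2 ^ (v + n) * o)                ≡⟨ ν₂-2^*odd (v + n) u ⟩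
  v + n                               ∎
  where
  open ≡-Reasoning
  v = ν₂ (suc w)
  o = 1 + 2 * u

≤ν₂⇒∣ : ∀ {j} n → j ≤ ν₂ (suc n) → 2 ^ j ∣ suc n
≤ν₂⇒∣ {j} n j≤ν with ν₂-decomposition n | m≤n⇒∃[o]m+o≡n j≤ν
... | u , e | d , j+d≡ν = divides (2 ^ d * o) (begin
  suc n                  ≡⟨ e ⟩
  2 ^ ν₂ (suc n) * o     ≡⟨ cong (λ v → 2 ^ v * o) (sym j+d≡ν) ⟩
  2 ^ (j + d) * o        ≡⟨ cong (_* o) (^-distribˡ-+-* 2 j d) ⟩
  2 ^ j * 2 ^ d * o      ≡⟨ *-assoc (2 ^ j) (2 ^ d) o ⟩
  2 ^ j * (2 ^ d * o)    ≡⟨ *-comm (2 ^ j) _ ⟩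
  2 ^ d * o * 2 ^ j      ∎)
  where
  open ≡-Reasoning
  o = 1 + 2 * u

∣⇒≤ν₂ : ∀ {j} n → 2 ^ j ∣ suc n → j ≤ ν₂ (suc n)
∣⇒≤ν₂ {j} n (divides (suc w) e) =
  subst (j ≤_) (sym (trans (cong ν₂ e) (ν₂-*2^ w j))) (m≤n+m j (ν₂ (suc w)))

ν₂-<-2^ : ∀ {j} n → suc n < 2 ^ j → ν₂ (suc n) < j
ν₂-<-2^ {j} n 1+n<2^j with ν₂ (suc n) <? j
... | yes ν<j = ν<j
... | no  ν≮j = contradiction (∣⇒≤ (≤ν₂⇒∣ n (≮⇒≥ ν≮j))) (<⇒≱ 1+n<2^j)

ν₂-+-multiple : ∀ {m} n t → ν₂ (suc n) < m → ν₂ (suc n + t * 2 ^ m) ≡ ν₂ (suc n)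
ν₂-+-multiple {m} n t ν<m with ν₂-decomposition n | m≤n⇒∃[o]m+o≡n ν<m
... | u , e | d , refl = begin
  ν₂ (suc n + t * 2 ^ (suc v + d))
    ≡⟨ cong₂ (λ a b → ν₂ (a + t * b)) e (^-distribˡ-+-* 2 (suc v) d) ⟩
  ν₂ (2 ^ v * (1 + 2 * u) + t * (2 * 2 ^ v * 2 ^ d))
    ≡⟨ cong ν₂ (shift (2 ^ v) (2 ^ d) u t) ⟩
  ν₂ (2 ^ v * (1 + 2 * (u + 2 ^ d * t)))
    ≡⟨ ν₂-2^*odd v (u + 2 ^ d * t) ⟩
  v ∎
  where
  open ≡-Reasoning
  v = ν₂ (suc n)
  shift : ∀ P Q u t → P * (1 + 2 * u) + t * (2 * P * Q) ≡ P * (1 + 2 * (u + Q * t))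
  shift = solve-∀

reach-residue : ∀ {r} → r < 4 → ∀ x → ∃[ d ] d ≤ 3 × ∃[ q ] x + d ≡ r + 4 * q
reach-residue {r} r<4 zero = r , s≤s⁻¹ r<4 , 0 , sym (+-identityʳ r)
reach-residue r<4 (suc x) with reach-residue r<4 x
... | suc d , d<3 , q , e = d , ≤-trans (n≤1+n d) d<3 , q , trans (sym (+-suc x d)) e
... | zero , _ , q , e = 3 , ≤-refl , suc q , next-period x q _ e
  where
  next-period : ∀ x q r → x + 0 ≡ r + 4 * q → suc x + 3 ≡ r + 4 * suc q
  next-period x q r e = trans (shift x) (trans (cong (_+ 4) e) (shift′ r q))
    where
    shift : ∀ x → suc x + 3 ≡ x + 0 + 4
    shift = solve-∀
    shift′ : ∀ r q → r + 4 * q + 4 ≡ r + 4 * suc q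
    shift′ = solve-∀

ν₂-≡-within-4 : ∀ n x → ∃[ d ] d ≤ 3 × ν₂ ((x + d) * 2 ^ n) ≡ n
ν₂-≡-within-4 n x with reach-residue {1} (s≤s (s≤s z≤n)) x
... | d , d≤3 , q , e = d , d≤3 ,
  trans (cong ν₂ (trans (cong (_* 2 ^ n) e) (odd (2 ^ n) q))) (ν₂-2^*odd n (2 * q))
  where
  odd : ∀ P q → (1 + 4 * q) * P ≡ P * (1 + 2 * (2 * q))
  odd = solve-∀

ν₂-≡-suc-within-4 : ∀ n x → ∃[ d ] d ≤ 3 × ν₂ ((x + d) * 2 ^ n) ≡ suc n
ν₂-≡-suc-within-4 n x with reach-residue {2} (s≤s (s≤s (s≤s z≤n))) x
... | d , d≤3 , q , e = d , d≤3 ,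
  trans (cong ν₂ (trans (cong (_* 2 ^ n) e) (twice-odd (2 ^ n) q))) (ν₂-2^*odd (suc n) q)
  where
  twice-odd : ∀ P q → (2 + 4 * q) * P ≡ 2 * P * (1 + 2 * q)
  twice-odd = solve-∀

d∣1+m<d+d⇒1+m≡d : ∀ {d m} → d ∣ suc m → suc m < d + d → suc m ≡ d
d∣1+m<d+d⇒1+m≡d     (divides zero ())
d∣1+m<d+d⇒1+m≡d {d} (divides (suc zero) e) _ = trans e (+-identityʳ d)
d∣1+m<d+d⇒1+m≡d {d} (divides (suc (suc q)) e) 1+m<d+d =
  contradiction (subst (d + d ≤_) (sym e) (+-monoʳ-≤ d (m≤m+n d (q * d)))) (<⇒≱ 1+m<d+d)

TwoValuedTails : {A : Set} → (ℕ → A) → Set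
TwoValuedTails g = ∀ {m l} → m ≤ l → g l ≡ g m ⊎ g l ≡ g (suc m)

twoValuedTails-∘ : ∀ {A B : Set} {g : ℕ → A} (h : A → B) →
  TwoValuedTails g → TwoValuedTails (h ∘ g)
twoValuedTails-∘ h twoValued m≤l = Sum.map (cong h) (cong h) (twoValued m≤l)

twoValuedTails-⊓ : ∀ {A : Set} {g : ℕ → A} j →
  TwoValuedTails g → TwoValuedTails (λ l → g (l ⊓ j))
twoValuedTails-⊓ {g = g} j twoValued {m} {l} m≤l with j ≤? m
... | yes j≤m = inj₁ (cong g (trans (m≥n⇒m⊓n≡n (≤-trans j≤m m≤l)) (sym (m≥n⇒m⊓n≡n j≤m))))
... | no  j≰m = Sum.map (λ e → trans e (cong g (sym (m≤n⇒m⊓n≡m m≤j))))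
                        (λ e → trans e (cong g (sym (m≤n⇒m⊓n≡m m<j))))
                        (twoValued (⊓-glb m≤l m≤j))
  where
  m<j = ≰⇒> j≰m
  m≤j = <⇒≤ m<j

toeplitz : {A : Set} → (ℕ → A) → ℕ → A
toeplitz g i = g (ν₂ (suc i))

module _ {A : Set} (g : ℕ → A) where

  toeplitz-stable : ∀ {n} x t → ν₂ (suc x) < n → toeplitz g (x + t * 2 ^ n) ≡ toeplitz g x
  toeplitz-stable x t ν<n = cong g (ν₂-+-multiple x t ν<n)

  toeplitz-shift : ∀ {n} x t t′ → suc x < 2 ^ n + 2 ^ n →
    g (ν₂ (suc t * 2 ^ n)) ≡ g (ν₂ (suc t′ * 2 ^ n)) →
    toeplitz g (x + t * 2 ^ n) ≡ toeplitz g (x + t′ * 2 ^ n)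
  toeplitz-shift {n} x t t′ 1+x<2P same with ν₂ (suc x) <? n
  ... | yes ν<n = trans (toeplitz-stable x t ν<n) (sym (toeplitz-stable x t′ ν<n))
  ... | no  ν≮n = begin
    g (ν₂ (suc x + t * 2 ^ n))    ≡⟨ cong (λ y → g (ν₂ (y + t * 2 ^ n))) 1+x≡P ⟩
    g (ν₂ (suc t * 2 ^ n))        ≡⟨ same ⟩
    g (ν₂ (suc t′ * 2 ^ n))       ≡⟨ cong (λ y → g (ν₂ (y + t′ * 2 ^ n))) 1+x≡P ⟨
    g (ν₂ (suc x + t′ * 2 ^ n))   ∎
    where
    open ≡-Reasoning
    1+x≡P : suc x ≡ 2 ^ n
    1+x≡P = d∣1+m<d+d⇒1+m≡d (≤ν₂⇒∣ x (≮⇒≥ ν≮n)) 1+x<2P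

window : ℕ → ℕ
window n = 5 * 2 ^ n + n

shifted-start-bounds : ∀ P .{{_ : NonZero P}} {a₀} s d → a₀ < P → d ≤ 3 →
  s ≤ a₀ + (suc (s / P) + d) * P × a₀ + (suc (s / P) + d) * P ≤ s + 5 * P
shifted-start-bounds P {a₀} s d a₀<P d≤3 = lower , upper
  where
  open ≤-Reasoning
  q = s / P
  lower : s ≤ a₀ + (suc q + d) * P
  lower = begin
    s                    ≡⟨ m≡m%n+[m/n]*n s P ⟩
    s % P + q * P        ≤⟨ +-monoˡ-≤ (q * P) (<⇒≤ (m%n<n s P)) ⟩
    suc q * P            ≤⟨ *-monoˡ-≤ P (m≤m+n (suc q) d) ⟩
    (suc q + d) * P      ≤⟨ m≤n+m _ a₀ ⟩
    a₀ + (suc q + d) * P ∎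
  upper : a₀ + (suc q + d) * P ≤ s + 5 * P
  upper = begin
    a₀ + (suc q + d) * P ≤⟨ +-mono-≤ (<⇒≤ a₀<P) (*-monoˡ-≤ P (+-monoʳ-≤ (suc q) d≤3)) ⟩
    P + (suc q + 3) * P  ≡⟨ regroup P q ⟩
    q * P + 5 * P        ≤⟨ +-monoˡ-≤ (5 * P) (m/n*n≤m s P) ⟩
    s + 5 * P            ∎
    where
    regroup : ∀ P q → P + (suc q + 3) * P ≡ q * P + 5 * P
    regroup = solve-∀

module _ {A : Set} {g : ℕ → A} (twoValued : TwoValuedTails g) where

  matching-shift : ∀ n t′ x →
    ∃[ d ] d ≤ 3 × g (ν₂ ((x + d) * 2 ^ n)) ≡ g (ν₂ (suc t′ * 2 ^ n))
  matching-shift n t′ x with twoValued (subst (n ≤_) (sym (ν₂-*2^ t′ n)) (m≤n+m n _))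
  ... | inj₁ e with ν₂-≡-within-4 n x
  ...   | d , d≤3 , ν≡n = d , d≤3 , trans (cong g ν≡n) (sym e)
  matching-shift n t′ x | inj₂ e with ν₂-≡-suc-within-4 n x
  ...   | d , d≤3 , ν≡1+n = d , d≤3 , trans (cong g ν≡1+n) (sym e)

  toeplitz-recurrent : ∀ n a s → ∃[ p ] s ≤ p × p + n ≤ s + window n ×
    (∀ k → k < n → toeplitz g (p + k) ≡ toeplitz g (a + k))
  toeplitz-recurrent n a s = p , proj₁ bounds , p+n≤ , agrees
    where
    instance
      2^n≢0 : NonZero (2 ^ n)
      2^n≢0 = m^n≢0 2 n
    P = 2 ^ n
    q = s / P
    shift = matching-shift n (a / P) (suc (suc q))
    d = proj₁ shift
    p = a % P + (suc q + d) * P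
    bounds = shifted-start-bounds P s d (m%n<n a P) (proj₁ (proj₂ shift))
    p+n≤ : p + n ≤ s + window n
    p+n≤ = ≤-trans (+-monoˡ-≤ n (proj₂ bounds)) (≤-reflexive (+-assoc s (5 * P) n))
    swap : ∀ a b c → a + b + c ≡ a + c + b
    swap = solve-∀
    agrees : ∀ k → k < n → toeplitz g (p + k) ≡ toeplitz g (a + k)
    agrees k k<n = begin
      toeplitz g (p + k)                       ≡⟨ cong (toeplitz g) (swap (a % P) _ k) ⟩
      toeplitz g (a % P + k + (suc q + d) * P)
        ≡⟨ toeplitz-shift g {n} (a % P + k) (suc q + d) (a / P) bound (proj₂ (proj₂ shift)) ⟩
      toeplitz g (a % P + k + a / P * P)       ≡⟨ cong (toeplitz g) (swap (a % P) k _) ⟩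
      toeplitz g (a % P + a / P * P + k)       ≡⟨ cong (λ b → toeplitz g (b + k)) (m≡m%n+[m/n]*n a P) ⟨
      toeplitz g (a + k)                       ∎
      where
      open ≡-Reasoning
      bound : suc (a % P + k) < P + P
      bound = ≤-<-trans (+-monoˡ-≤ k (m%n<n a P)) (+-monoʳ-< P (<-trans k<n (n<2^n n)))

module _ {k : ℕ} {g : ℕ → Fin k} (twoValued : TwoValuedTails g) where

  occurrence-recurs : ∀ {n} (x : Vec (Fin k) n) a → OccursAt (toeplitz g) x a →
    ∀ s → OccursInWindow (toeplitz g) x s (window n)
  occurrence-recurs {n} x a occ s with toeplitz-recurrent twoValued n a s
  ... | p , s≤p , p+n≤ , agrees =
    p , s≤p , p+n≤ , λ m → trans (agrees (toℕ m) (toℕ<n m)) (occ m)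

  toeplitz-stronglyAlmostPeriodic : StronglyAlmostPeriodic (toeplitz g)
  toeplitz-stronglyAlmostPeriodic i n =
    window (suc n) , occurrence-recurs (factor (toeplitz g) i n) i
                       (λ m → sym (lookup∘tabulate (λ m → toeplitz g (i + toℕ m)) m))

  toeplitz-regulator : Regulator (toeplitz g) window
  toeplitz-regulator =
      (λ n x infinitely → let p , _ , occ = infinitely 0 in occurrence-recurs x p occ)
    , (λ n x finitely p _ occ → finitely (λ N → recur-after x N (occurrence-recurs x p occ N)))
    where
    recur-after : ∀ {n} (x : Vec (Fin k) n) N → OccursInWindow (toeplitz g) x N (window n) →
      Σ ℕ λ p → (N ≤ p) × OccursAt (toeplitz g) x p
    recur-after x N (p , N≤p , _ , occ) = p , N≤p , occ

toeplitz-aperiodic : ∀ {k} (g : ℕ → Fin k) → (∀ v → g (suc v) ≢ g v) → ¬ Periodic (toeplitz g)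
toeplitz-aperiodic g jumps (zero , () , _)
toeplitz-aperiodic g jumps (suc T , _ , periodic) =
  jumps v (sym (trans (periodic T) (cong g (trans (cong ν₂ (double (suc T))) ν₂[2T]≡1+v))))
  where
  v = ν₂ (suc T)
  double : ∀ m → m + m ≡ m * 2 ^ 1
  double = solve-∀
  ν₂[2T]≡1+v : ν₂ (suc T * 2 ^ 1) ≡ suc v
  ν₂[2T]≡1+v = trans (ν₂-*2^ T 1) (+-comm v 1)

toeplitz-⊓-periodic : ∀ {k} (g : ℕ → Fin k) j → Periodic (toeplitz (λ l → g (l ⊓ j)))
toeplitz-⊓-periodic g j = 2 ^ j , m^n>0 2 j , same
  where
  gⱼ : ℕ → Fin _
  gⱼ l = g (l ⊓ j)
  same : ∀ i → toeplitz gⱼ i ≡ toeplitz gⱼ (i + 2 ^ j)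
  same i with ν₂ (suc i) <? j
  ... | yes ν<j = sym (trans (cong (λ m → toeplitz gⱼ (i + m)) (sym (*-identityˡ (2 ^ j))))
                             (toeplitz-stable gⱼ i 1 ν<j))
  ... | no  ν≮j = cong g (trans (m≥n⇒m⊓n≡n j≤ν) (sym (m≥n⇒m⊓n≡n j≤ν′)))
    where
    j≤ν = ≮⇒≥ ν≮j
    j≤ν′ : j ≤ ν₂ (suc i + 2 ^ j)
    j≤ν′ = ∣⇒≤ν₂ (i + 2 ^ j) (∣m∣n⇒∣m+n (≤ν₂⇒∣ i j≤ν) ∣-refl)

toeplitz-⊓-agrees : ∀ {A : Set} (g : ℕ → A) {j i} → suc i < 2 ^ j →
  toeplitz (λ l → g (l ⊓ j)) i ≡ toeplitz g i
toeplitz-⊓-agrees g {i = i} 1+i<2^j = cong g (m≤n⇒m⊓n≡m (<⇒≤ (ν₂-<-2^ i 1+i<2^j)))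

bit : ∀ {k} → Bool → Fin (2 + k)
bit false = zero
bit true  = suc zero

bit-not : ∀ {k} b → bit {k} (not b) ≢ bit b
bit-not false ()
bit-not true  ()

alternating : ℕ → Bool
alternating zero    = false
alternating (suc n) = not (alternating n)

same-or-not : ∀ b c → b ≡ c ⊎ b ≡ not c
same-or-not false false = inj₁ refl
same-or-not false true  = inj₂ refl
same-or-not true  false = inj₂ refl
same-or-not true  true  = inj₁ refl

alternating-twoValuedTails : TwoValuedTails alternating
alternating-twoValuedTails {m} {l} _ = same-or-not (alternating l) (alternating m)

queryIndexBound : Query → ℕ
queryIndexBound (qω i) = suc i
queryIndexBound (qf _) = 0

queryBound : ∀ {k} → ℕ → OracleAlgorithm k → Seq k → (ℕ → ℕ) → List (Answer k) → ℕ
queryBound fuel A ω f h with A h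
... | halt _ = 0
... | ask q with fuel
...   | zero     = 0
...   | suc fuel = queryIndexBound q ⊔ queryBound fuel A ω f (answer ω f q ∷ h)

run-cong : ∀ {k} fuel (A : OracleAlgorithm k) ω ω′ f h →
  (∀ i → i < queryBound fuel A ω f h → ω i ≡ ω′ i) → run fuel A ω f h ≡ run fuel A ω′ f h
run-cong fuel A ω ω′ f h agree with A h
... | halt _ = refl
... | ask q with fuel
...   | zero     = refl
...   | suc fuel = trans
  (run-cong fuel A ω ω′ f (answer ω f q ∷ h) (λ i i< → agree i (≤-trans i< (m≤n⊔m _ _))))
  (cong (λ r → run fuel A ω′ f (r ∷ h)) (same-answer q (λ i i< → agree i (≤-trans i< (m≤m⊔n _ _)))))
  where
  same-answer : ∀ q → (∀ i → i < queryIndexBound q → ω i ≡ ω′ i) → answer ω f q ≡ answer ω′ f q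
  same-answer (qω i) agree = cong inj₁ (agree i ≤-refl)
  same-answer (qf i) _     = refl

run-mono : ∀ {k} {m n} (A : OracleAlgorithm k) ω f h {b} → m ≤ n →
  run m A ω f h ≡ just b → run n A ω f h ≡ just b
run-mono {m = m} {n} A ω f h m≤n halts with A h
... | halt _ = halts
... | ask q with m | n | m≤n
...   | suc m | suc n | s≤s m≤n = run-mono A ω f (answer ω f q ∷ h) m≤n halts

haltsWith-functional : ∀ {k} {A : OracleAlgorithm k} {ω f b b′} →
  HaltsWith A ω f b → HaltsWith A ω f b′ → b ≡ b′
haltsWith-functional {A = A} {ω} {f} (m , halts) (n , halts′) with ≤-total m n
... | inj₁ m≤n = just-injective (trans (sym (run-mono A ω f [] m≤n halts)) halts′)
... | inj₂ n≤m = just-injective (trans (sym halts) (run-mono A ω f [] n≤m halts′))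

halts-on-agreeing : ∀ {k} {n} {A : OracleAlgorithm k} {ω ω′ f b} → run n A ω f [] ≡ just b →
  (∀ i → i < queryBound n A ω f [] → ω i ≡ ω′ i) → HaltsWith A ω′ f b
halts-on-agreeing {n = n} {A} {ω} {ω′} {f} halts agree =
  n , trans (sym (run-cong n A ω ω′ f [] agree)) halts

theorem8 : (k : ℕ) → 2 ≤ k →
    ¬ (Σ (OracleAlgorithm k) λ A →
         (ω : Seq k) (f : ℕ → ℕ) →
         StronglyAlmostPeriodic ω → Regulator ω f →
         Σ Bool λ b → HaltsWith A ω f b
           × (b ≡ true → Periodic ω) × (b ≡ false → ¬ Periodic ω))
theorem8 zero          ()
theorem8 (suc zero)    (s≤s ())
theorem8 (suc (suc k)) _ (A , decides) =
  refute (decides ω∞ window (sap g∞-twoValued) (reg g∞-twoValued))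
  where
  sap = toeplitz-stronglyAlmostPeriodic
  reg = toeplitz-regulator
  g∞ : ℕ → Fin (2 + k)
  g∞ = bit ∘ alternating
  g∞-twoValued : TwoValuedTails g∞
  g∞-twoValued = twoValuedTails-∘ bit alternating-twoValuedTails
  ω∞ : Seq (2 + k)
  ω∞ = toeplitz g∞
  ω⊓ : ℕ → Seq (2 + k)
  ω⊓ j = toeplitz (λ l → g∞ (l ⊓ j))
  refute : Σ Bool (λ b → HaltsWith A ω∞ window b
                          × (b ≡ true → Periodic ω∞) × (b ≡ false → ¬ Periodic ω∞)) → ⊥
  refute (true  , _ , periodic , _) = toeplitz-aperiodic g∞ (bit-not ∘ alternating) (periodic refl)
  refute (false , (n , halts) , _ , _) =
    let _ , haltsᴮ , _ , aperiodic = decides (ω⊓ B) window (sap twoValuedᴮ) (reg twoValuedᴮ)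
    in aperiodic (haltsWith-functional {A = A} haltsᴮ (halts-on-agreeing {A = A} halts agree))
                 (toeplitz-⊓-periodic g∞ B)
    where
    B = queryBound n A ω∞ window []
    twoValuedᴮ = twoValuedTails-⊓ B g∞-twoValued
    agree : ∀ i → i < B → ω∞ i ≡ ω⊓ B i
    agree i i<B = sym (toeplitz-⊓-agrees g∞ (≤-<-trans i<B (n<2^n B)))
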